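{- Let $q$ be a prime power, $n$ a positive integer coprime to $q$, $\gamma\in\mathbb{Z}/n\mathbb{Z}$ (viewed as an integer), $\tau=|c_{n/q}(\gamma)|$, and $\omega_\gamma$ as in the context. Then the leader of $c_{n/q}(\gamma)$ is $$\min\Big\{\gamma q^j \ (\mathrm{mod}\ \tfrac{\omega_\gamma n}{\tau}) : j=0,1,\dots,\omega_\gamma-1\Big\}.$$
   Context: $c_{n/q}(\gamma)=\{\gamma,\gamma q,\dots,\gamma q^{\tau-1}\}\subseteq\mathbb{Z}/n\mathbb{Z}$ with $\tau$ the least positive integer with $\gamma q^\tau\equiv\gamma\pmod n$. The leader of a coset is the smallest of its elements when each is represented by an integer in $\{0,1,\dots,n-1\}$. For integers $m$ and $N>0$, $m\ (\mathrm{mod}\ N)$ denotes the unique integer in $\{0,\dots,N-1\}$ congruent to $m$ modulo $N$. With $n_\gamma=n/\gcd(\gamma,n)$, $\mathrm{rad}(m)$ the product of the distinct primes dividing $m$ and $\mathrm{ord}_m(q)$ the order of $q$ modulo $m$: $\omega_\gamma=2\,\mathrm{ord}_{\mathrm{rad}(n_\gamma)}(q)$ if $q^{\mathrm{ord}_{\mathrm{rad}(n_\gamma)}(q)}\equiv3\pmod4$ and $8\mid n_\gamma$, and $\omega_\gamma=\mathrm{ord}_{\mathrm{rad}(n_\gamma)}(q)$ otherwise. -}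

module Defs where

open import Data.Nat using (ℕ; zero; suc; _+_; _*_; _^_; _≤_; _<_; _/_; _%_; ∣_-_∣)
open import Data.Nat.Divisibility using (_∣_; _∣?_)
open import Data.Nat.GCD using (gcd)
open import Data.Nat.Primality using (Prime; prime?)
open import Data.List using (List; filter; upTo)
open import Data.Nat.ListAction using (product)
open import Data.Product using (Σ; ∃; _×_)
open import Relation.Nullary using (¬_; does)
open import Data.Bool using (if_then_else_)
open import Data.Nat using (_≟_)
open import Relation.Nullary.Decidable using (_×-dec_)
open import Relation.Binary.PropositionalEquality using (_≡_)

CongMod : ℕ → ℕ → ℕ → Set
CongMod m a b = m ∣ ∣ a - b ∣

-- m (mod N) : the representative in {0,…,N-1}; only ever used with N > 0
-- (the value for N = 0 is an irrelevant fallback).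
_mod_ : ℕ → ℕ → ℕ
m mod zero = m
m mod suc k = m % suc k

-- natural-number division; only ever used with nonzero divisor
-- (the value for divisor 0 is an irrelevant fallback).
_div_ : ℕ → ℕ → ℕ
m div zero = m
m div suc k = m / suc k

IsPrimePower : ℕ → Set
IsPrimePower q = Σ ℕ λ p → Σ ℕ λ k → Prime p × 1 ≤ k × q ≡ p ^ k

rad : ℕ → ℕ
rad m = product (filter (λ p → prime? p ×-dec p ∣? m) (upTo (suc m)))

IsLeastPos : (ℕ → Set) → ℕ → Set
IsLeastPos P t = 1 ≤ t × P t × (∀ s → 1 ≤ s → s < t → ¬ P s)

IsOrd : ℕ → ℕ → ℕ → Set
IsOrd m q o = IsLeastPos (λ t → CongMod m (q ^ t) 1) o

IsCosetSize : ℕ → ℕ → ℕ → ℕ → Set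
IsCosetSize n q γ τ = IsLeastPos (λ t → CongMod n (γ * q ^ t) γ) τ

CosetElem : ℕ → ℕ → ℕ → ℕ → ℕ → Set
CosetElem n q γ τ x = ∃ λ i → i < τ × x ≡ (γ * q ^ i) mod n

IsMinOf : (ℕ → Set) → ℕ → Set
IsMinOf S x = S x × (∀ y → S y → x ≤ y)

IsLeader : ℕ → ℕ → ℕ → ℕ → ℕ → Set
IsLeader n q γ τ ℓ = IsMinOf (CosetElem n q γ τ) ℓ

nγ : ℕ → ℕ → ℕ
nγ n γ = n div gcd γ n

omega : ℕ → ℕ → ℕ → ℕ → ℕ
omega n q γ o =
  if does ((((q ^ o) mod 4) ≟ 3) ×-dec (8 ∣? nγ n γ)) then 2 * o else o

module Submission where

-- Write d = gcd(γ, n), n = d·N and γ = d·γ′ with γ′ prime to N = n_γ; then τ = ord_N(q).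
-- The exponent ω divides τ, and u = q^ω is 1 modulo every prime of N (and modulo 4 when
-- 8 ∣ N), so lifting the exponent gives ord_N(u) = N/g with g = gcd(u − 1, N). Hence
-- τ = ω·t, N = g·t and ω·n/τ = d·g. Split each exponent i < τ as i = j + ω·k with j < ω,
-- k < t. All γq^(j+ωk) are congruent to γq^j modulo d·g, so their residues mod n are at
-- least γq^j mod d·g; and as k runs below t, x·u^k (x = γ′q^j) runs through all t residues
-- mod N in the class of x mod g, so one of them is x mod g itself, and scaling by d shows
-- that the minimum γq^j mod d·g is attained. Minimising over j gives the formula.

open import Defs
open import Data.Bool using (if_then_else_)
open import Data.Empty using (⊥-elim)
open import Data.Fin as Fin using (Fin; toℕ; fromℕ<; punchOut)
open import Data.Fin.Properties
  using (toℕ-fromℕ<; toℕ<n; toℕ-injective; punchOut-injective; injective⇒≤; any?)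
import Data.Integer as ℤ
import Data.Integer.Divisibility.Signed as ℤ∣
import Data.Integer.Properties as ℤₚ
open import Data.List using ([]; _∷_; upTo)
open import Data.List.Membership.Propositional.Properties using (∈-upTo⁺; ∈-filter⁺)
open import Data.List.Relation.Unary.All as All using (All; []; _∷_)
open import Data.List.Relation.Unary.All.Properties using (All¬⇒¬Any; all-filter)
open import Data.List.Relation.Unary.AllPairs using ([]; _∷_)
open import Data.List.Relation.Unary.Unique.Propositional using (Unique)
import Data.List.Relation.Unary.Unique.Propositional.Properties as Unique
open import Data.Nat
  using (ℕ; zero; suc; _+_; _*_; _∸_; _^_; _<_; _≤_; z≤n; s≤s; _≟_; _%_; _/_; ∣_-_∣;
         NonZero; >-nonZero; >-nonZero⁻¹; ≢-nonZero; ≢-nonZero⁻¹)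
open import Data.Nat.Coprimality using (Coprime; coprime-divisor; coprime⇒gcd≡1; coprime-/gcd)
  renaming (sym to coprime-sym)
open import Data.Nat.DivMod hiding (_mod_; _div_)
open import Data.Nat.Divisibility
open import Data.Nat.GCD using (gcd; gcd[m,n]∣m; gcd[m,n]∣n; gcd[m,n]≢0; gcd-greatest)
open import Data.Nat.LCM using (lcm; lcm-least; gcd*lcm)
open import Data.Nat.ListAction using (product)
open import Data.Nat.ListAction.Properties using (∈⇒∣product)
open import Data.Nat.Primality
  using (Prime; prime?; prime⇒nonZero; prime[2]; ¬prime[1]; prime⇒irreducible; euclidsLemma)
open import Data.Nat.Primality.Factorisation using (factorise; factorisationHasAllPrimeFactors)
open import Data.Nat.Properties
open import Data.Nat.Tactic.RingSolver using (solve-∀)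
open import Data.Product using (∃; ∃₂; _×_; _,_; proj₁; proj₂)
open import Data.Sum using (_⊎_; inj₁; inj₂; [_,_]′)
open import Function.Definitions using (Injective)
open import Relation.Binary.PropositionalEquality
  using (_≡_; _≢_; refl; sym; trans; cong; cong₂; subst; subst₂; module ≡-Reasoning)
open import Relation.Nullary using (¬_; Dec; yes; no; does)
open import Relation.Nullary.Decidable using (_×-dec_; decidable-stable)

-- Congruences

infix 4 _≡_[mod_]

-- Divisibility of the integer difference; equivalent to Defs.CongMod (see CongMod⇒≡mod),
-- but transitive and compatible with + and * without case analysis on ∣ x - y ∣.
record _≡_[mod_] (x y m : ℕ) : Set where
  constructor mk≡mod
  field divides-difference : ℤ.+ m ℤ∣.∣ ℤ.+ x ℤ.- ℤ.+ y

module _ where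
  open ℤ using (ℤ; +_; -_; _-_)
  open import Data.Integer.Tactic.RingSolver using () renaming (solve-∀ to solve-ℤ)

  private
    ∣+x-+y∣≡∣x-y∣ : ∀ x y → ℤ.∣ + x - + y ∣ ≡ ∣ x - y ∣
    ∣+x-+y∣≡∣x-y∣ x y with ≤-total x y
    ... | inj₁ x≤y = trans (cong ℤ.∣_∣ (ℤₚ.[+m]-[+n]≡m⊖n x y))
                           (trans (ℤₚ.∣⊖∣-≤ x≤y) (sym (m≤n⇒∣m-n∣≡n∸m x≤y)))
    ... | inj₂ y≤x = trans (cong ℤ.∣_∣ (ℤₚ.[+m]-[+n]≡m⊖n x y))
                           (trans (ℤₚ.∣m⊖n∣≡∣n⊖m∣ x y)
                           (trans (ℤₚ.∣⊖∣-≤ y≤x) (trans (sym (m≤n⇒∣m-n∣≡n∸m y≤x)) (∣-∣-comm y x))))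

    ∣-by : ∀ {m} {i j : ℤ} → i ≡ j → + m ℤ∣.∣ i → + m ℤ∣.∣ j
    ∣-by {m} = subst (+ m ℤ∣.∣_)

  CongMod⇒≡mod : ∀ {m x y} → CongMod m x y → x ≡ y [mod m ]
  CongMod⇒≡mod {m} {x} {y} m∣ = mk≡mod (ℤ∣.∣ᵤ⇒∣ (subst (m ∣_) (sym (∣+x-+y∣≡∣x-y∣ x y)) m∣))

  ≡mod⇒CongMod : ∀ {m x y} → x ≡ y [mod m ] → CongMod m x y
  ≡mod⇒CongMod {m} {x} {y} (mk≡mod m∣) = subst (m ∣_) (∣+x-+y∣≡∣x-y∣ x y) (ℤ∣.∣⇒∣ᵤ m∣)

  ≡mod-refl : ∀ {m} x → x ≡ x [mod m ]
  ≡mod-refl x = mk≡mod (∣-by (sym (ℤₚ.i≡j⇒i-j≡0 {+ x} refl)) (ℤ∣.divides (+ 0) refl))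

  ≡mod-sym : ∀ {m x y} → x ≡ y [mod m ] → y ≡ x [mod m ]
  ≡mod-sym {x = x} {y} (mk≡mod m∣) = mk≡mod (∣-by (eq (+ x) (+ y)) (ℤ∣.∣m⇒∣-m m∣))
    where
    eq : ∀ (i j : ℤ) → - (i - j) ≡ j - i
    eq = solve-ℤ

  ≡mod-trans : ∀ {m x y z} → x ≡ y [mod m ] → y ≡ z [mod m ] → x ≡ z [mod m ]
  ≡mod-trans {x = x} {y} {z} (mk≡mod m∣x-y) (mk≡mod m∣y-z) =
    mk≡mod (∣-by (eq (+ x) (+ y) (+ z)) (ℤ∣.∣m∣n⇒∣m+n m∣x-y m∣y-z))
    where
    eq : ∀ (i j k : ℤ) → (i - j) ℤ.+ (j - k) ≡ i - k
    eq = solve-ℤ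

  ≡mod-* : ∀ {m x y z w} → x ≡ y [mod m ] → z ≡ w [mod m ] → x * z ≡ y * w [mod m ]
  ≡mod-* {x = x} {y} {z} {w} (mk≡mod m∣x-y) (mk≡mod m∣z-w) =
    mk≡mod (∣-by eq (ℤ∣.∣m∣n⇒∣m+n (ℤ∣.∣m⇒∣m*n (+ z) m∣x-y) (ℤ∣.∣n⇒∣m*n (+ y) m∣z-w)))
    where
    ring : ∀ (a b c e : ℤ) → (a - b) ℤ.* c ℤ.+ b ℤ.* (c - e) ≡ a ℤ.* c - b ℤ.* e
    ring = solve-ℤ
    eq : (+ x - + y) ℤ.* + z ℤ.+ + y ℤ.* (+ z - + w) ≡ + (x * z) - + (y * w)
    eq = trans (ring (+ x) (+ y) (+ z) (+ w)) (sym (cong₂ _-_ (ℤₚ.pos-* x z) (ℤₚ.pos-* y w)))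

  ≡mod-∣ : ∀ {d m x y} → d ∣ m → x ≡ y [mod m ] → x ≡ y [mod d ]
  ≡mod-∣ d∣m (mk≡mod m∣) = mk≡mod (ℤ∣.∣-trans (ℤ∣.∣ᵤ⇒∣ d∣m) m∣)

  +-multiple-≡mod : ∀ {m z} x → m ∣ z → x + z ≡ x [mod m ]
  +-multiple-≡mod {m} {z} x m∣z = mk≡mod (∣-by eq (ℤ∣.∣ᵤ⇒∣ m∣z))
    where
    ring : ∀ (i j : ℤ) → j ≡ (i ℤ.+ j) - i
    ring = solve-ℤ
    eq : + z ≡ + (x + z) - + x
    eq = trans (ring (+ x) (+ z)) (cong (_- + x) (sym (ℤₚ.pos-+ x z)))

≡mod-^ : ∀ {m x y} → x ≡ y [mod m ] → ∀ k → x ^ k ≡ y ^ k [mod m ]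
≡mod-^ x≡y zero = ≡mod-refl 1
≡mod-^ x≡y (suc k) = ≡mod-* x≡y (≡mod-^ x≡y k)

^-≡1 : ∀ {m x} → x ≡ 1 [mod m ] → ∀ k → x ^ k ≡ 1 [mod m ]
^-≡1 {m} {x} x≡1 k = subst (x ^ k ≡_[mod m ]) (^-zeroˡ k) (≡mod-^ x≡1 k)

≡mod⇒∣∸ : ∀ {m x y} → y ≤ x → x ≡ y [mod m ] → m ∣ x ∸ y
≡mod⇒∣∸ {m} y≤x x≡y = subst (m ∣_) (m≤n⇒∣n-m∣≡n∸m y≤x) (≡mod⇒CongMod x≡y)

≡mod-scale : ∀ {m x y} d → x ≡ y [mod m ] → d * x ≡ d * y [mod d * m ]
≡mod-scale {m} {x} {y} d x≡y =
  CongMod⇒≡mod (subst (d * m ∣_) (*-distribˡ-∣-∣ d x y) (*-monoʳ-∣ d (≡mod⇒CongMod x≡y)))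

≡mod-unscale : ∀ {m x y} d .{{_ : NonZero d}} → d * x ≡ d * y [mod d * m ] → x ≡ y [mod m ]
≡mod-unscale {m} {x} {y} d dx≡dy =
  CongMod⇒≡mod (*-cancelˡ-∣ d (subst (d * m ∣_) (sym (*-distribˡ-∣-∣ d x y)) (≡mod⇒CongMod dx≡dy)))

≡mod-cancel : ∀ {m c x y} → Coprime m c → c * x ≡ c * y [mod m ] → x ≡ y [mod m ]
≡mod-cancel {m} {c} {x} {y} m⊥c cx≡cy =
  CongMod⇒≡mod (coprime-divisor m⊥c (subst (m ∣_) (sym (*-distribˡ-∣-∣ c x y)) (≡mod⇒CongMod cx≡cy)))

%-≡mod : ∀ x m .{{_ : NonZero m}} → x % m ≡ x [mod m ]
%-≡mod x m = subst (λ x′ → x % m ≡ x′ [mod m ]) (sym (m≡m%n+[m/n]*n x m))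
                   (≡mod-sym (+-multiple-≡mod (x % m) (n∣m*n (x / m))))

≡mod⇒%≡ : ∀ {m x y} .{{_ : NonZero m}} → x ≡ y [mod m ] → x % m ≡ y % m
≡mod⇒%≡ {m} {x} {y} x≡y = ∣m-n∣≡0⇒m≡n (trans (sym (m<n⇒m%n≡m diff<m)) (n∣m⇒m%n≡0 _ m m∣diff))
  where
  m∣diff : m ∣ ∣ x % m - y % m ∣
  m∣diff = ≡mod⇒CongMod (≡mod-trans (%-≡mod x m) (≡mod-trans x≡y (≡mod-sym (%-≡mod y m))))
  diff<m : ∣ x % m - y % m ∣ < m
  diff<m = ≤-<-trans (∣m-n∣≤m⊔n (x % m) (y % m)) (⊔-pres-<m (m%n<n x m) (m%n<n y m))

%≡⇒≡mod : ∀ {m x y} .{{_ : NonZero m}} → x % m ≡ y % m → x ≡ y [mod m ]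
%≡⇒≡mod {m} {x} {y} eq =
  ≡mod-trans (≡mod-sym (%-≡mod x m)) (subst (_≡ y [mod m ]) (sym eq) (%-≡mod y m))

mod≡% : ∀ x m .{{_ : NonZero m}} → x mod m ≡ x % m
mod≡% x (suc m) = refl

div≡/ : ∀ x m .{{_ : NonZero m}} → x div m ≡ x / m
div≡/ x (suc m) = refl

*-distribˡ-% : ∀ d x m .{{_ : NonZero d}} .{{_ : NonZero m}} .{{_ : NonZero (d * m)}} →
               d * (x % m) ≡ (d * x) % (d * m)
*-distribˡ-% d@(suc _) x m@(suc _) = begin
  d * (x % m)       ≡⟨ *-comm d (x % m) ⟩
  x % m * d         ≡⟨ m%n*o≡m*o%[n*o] x m d ⟩
  (x * d) % (m * d) ≡⟨ %-congˡ (*-comm x d) ⟩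
  (d * x) % (m * d) ≡⟨ %-congʳ {o = d * x} (*-comm m d) ⟩
  (d * x) % (d * m) ∎
  where open ≡-Reasoning

≡mod⇒%≤% : ∀ {M n y z} .{{_ : NonZero M}} .{{_ : NonZero n}} → M ∣ n → y ≡ z [mod M ] → z % M ≤ y % n
≡mod⇒%≤% {M} {n} {y} {z} M∣n y≡z =
  subst (_≤ y % n) (trans (m∣n⇒o%n%m≡o%m M n y M∣n) (≡mod⇒%≡ y≡z)) (m%n≤m (y % n) M)

-- Coprimality and primes

coprime-* : ∀ {m x y} → Coprime m x → Coprime m y → Coprime m (x * y)
coprime-* m⊥x m⊥y (d∣m , d∣xy) =
  m⊥y (d∣m , coprime-divisor (λ (e∣d , e∣x) → m⊥x (∣-trans e∣d d∣m , e∣x)) d∣xy)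

coprime-^ : ∀ {m x} → Coprime m x → ∀ k → Coprime m (x ^ k)
coprime-^ m⊥x zero (_ , d∣1) = ∣1⇒≡1 d∣1
coprime-^ m⊥x (suc k) = coprime-* m⊥x (coprime-^ m⊥x k)

coprime-∣∣ : ∀ {m n x} → Coprime m n → m ∣ x → n ∣ x → m * n ∣ x
coprime-∣∣ {m} {n} m⊥n m∣x n∣x = subst (_∣ _) lcm≡m*n (lcm-least m∣x n∣x)
  where
  lcm≡m*n : lcm m n ≡ m * n
  lcm≡m*n = trans (sym (*-identityˡ _)) (trans (cong (_* lcm m n) (sym (coprime⇒gcd≡1 m⊥n))) (gcd*lcm m n))

prime∤1 : ∀ {p} → Prime p → ¬ p ∣ 1
prime∤1 p-prime p∣1 = ¬prime[1] (subst Prime (∣1⇒≡1 p∣1) p-prime)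

prime∣x⇒∤1+x : ∀ {p x} → Prime p → p ∣ x → ¬ p ∣ 1 + x
prime∣x⇒∤1+x {p} {x} p-prime p∣x p∣1+x =
  prime∤1 p-prime (∣m+n∣m⇒∣n (subst (p ∣_) (+-comm 1 x) p∣1+x) p∣x)

prime∤⇒coprime : ∀ {p x} → Prime p → ¬ p ∣ x → Coprime p x
prime∤⇒coprime p-prime p∤x (d∣p , d∣x) with prime⇒irreducible p-prime d∣p
... | inj₁ d≡1 = d≡1
... | inj₂ refl = ⊥-elim (p∤x d∣x)

∃-prime-divisor : ∀ {m} → 2 ≤ m → ∃ λ p → Prime p × p ∣ m
∃-prime-divisor {m@(suc _)} m≥2 with factorise m
... | record { factors = [] ; isFactorisation = m≡1 } = ⊥-elim (<⇒≢ m≥2 (sym m≡1))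
... | record { factors = p ∷ ps ; isFactorisation = m≡p*ps ; factorsPrime = p-prime ∷ _ } =
  p , p-prime , divides (product ps) (trans m≡p*ps (*-comm p (product ps)))

proper-divisor⇒prime-cofactor : ∀ {t m} → 1 ≤ m → t ∣ m → t ≢ m →
                                ∃₂ λ p m′ → Prime p × m ≡ m′ * p × t ∣ m′
proper-divisor⇒prime-cofactor {t} {m} m≥1 (divides s m≡st) t≢m = split s m≡st
  where
  split : ∀ s → m ≡ s * t → ∃₂ λ p m′ → Prime p × m ≡ m′ * p × t ∣ m′
  split 0 m≡0 = ⊥-elim (<⇒≢ m≥1 (sym m≡0))
  split 1 m≡t = ⊥-elim (t≢m (sym (trans m≡t (+-identityʳ t))))
  split s@(suc (suc _)) m≡st with ∃-prime-divisor {s} (s≤s (s≤s z≤n))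
  ... | p , p-prime , divides s′ s≡s′p =
    p , s′ * t , p-prime , trans m≡st (trans (cong (_* t) s≡s′p) (reorder s′ p t)) , n∣m*n s′
    where
    reorder : ∀ a b c → a * b * c ≡ a * c * b
    reorder = solve-∀

prime∣2⇒≡2 : ∀ {r} → Prime r → r ∣ 2 → r ≡ 2
prime∣2⇒≡2 r-prime r∣2 with prime⇒irreducible prime[2] r∣2
... | inj₁ refl = ⊥-elim (¬prime[1] r-prime)
... | inj₂ r≡2 = r≡2

odd-prime : ∀ {p} → Prime p → p ≢ 2 → ∃ λ h → p ≡ 1 + 2 * h
odd-prime {p} p-prime p≢2 with p % 2 in p%2≡r | m%n<n p 2
... | 0 | _ with prime⇒irreducible p-prime (m%n≡0⇒n∣m p 2 p%2≡r)
...   | inj₂ 2≡p = ⊥-elim (p≢2 (sym 2≡p))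
odd-prime {p} p-prime p≢2 | 1 | _ =
  p / 2 , trans (m≡m%n+[m/n]*n p 2) (trans (cong (_+ (p / 2) * 2) p%2≡r) (cong suc (*-comm (p / 2) 2)))
odd-prime p-prime p≢2 | suc (suc _) | s≤s (s≤s ())

prime-power≥1 : ∀ {q} → IsPrimePower q → 1 ≤ q
prime-power≥1 (p , k , p-prime , _ , refl) = m^n>0 p ⦃ prime⇒nonZero p-prime ⦄ k

prime∣⇒∣rad : ∀ {p N} → 1 ≤ N → Prime p → p ∣ N → p ∣ rad N
prime∣⇒∣rad {p} {N@(suc _)} _ p-prime p∣N =
  ∈⇒∣product (∈-filter⁺ (λ p → prime? p ×-dec p ∣? N) (∈-upTo⁺ (s≤s (∣⇒≤ p∣N))) (p-prime , p∣N))

distinct-prime-divisors⇒product∣ : ∀ {N ps} → Unique ps → All (λ p → Prime p × p ∣ N) ps → product ps ∣ N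
distinct-prime-divisors⇒product∣ {ps = []} _ _ = 1∣ _
distinct-prime-divisors⇒product∣ {ps = p ∷ ps} (p∉ps ∷ unique) ((p-prime , p∣N) ∷ divisors) =
  coprime-∣∣ p⊥ps p∣N (distinct-prime-divisors⇒product∣ unique divisors)
  where
  p⊥ps : Coprime p (product ps)
  p⊥ps = prime∤⇒coprime p-prime λ p∣ps →
    All¬⇒¬Any p∉ps (factorisationHasAllPrimeFactors p-prime p∣ps (All.map proj₁ divisors))

rad∣ : ∀ N → rad N ∣ N
rad∣ N = distinct-prime-divisors⇒product∣ (Unique.filter⁺ radical? (Unique.upTo⁺ (suc N)))
                                          (all-filter radical? (upTo (suc N)))
  where
  radical? = λ p → prime? p ×-dec p ∣? N

-- Multiplicative order

∣∧<⇒≡0 : ∀ {t e} .{{_ : NonZero t}} → t ∣ e → e < t → e ≡ 0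
∣∧<⇒≡0 {t} {e} t∣e e<t = trans (sym (m<n⇒m%n≡m e<t)) (n∣m⇒m%n≡0 e t t∣e)

IsLeastPos-⇔ : ∀ {P Q : ℕ → Set} {o} → (∀ k → P k → Q k) → (∀ k → Q k → P k) →
               IsLeastPos P o → IsLeastPos Q o
IsLeastPos-⇔ P⇒Q Q⇒P (o≥1 , Po , least) = o≥1 , P⇒Q _ Po , λ s s≥1 s<o Qs → least s s≥1 s<o (Q⇒P s Qs)

module _ {P : ℕ → Set} (P-+ : ∀ a b → P a → P b → P (a + b))
                       (P-∸ : ∀ a b → P a → P (a + b) → P b) where

  P-multiple : ∀ {o} → P o → ∀ s → P (s * o)
  P-multiple {o} Po zero = P-∸ o 0 Po (subst P (sym (+-identityʳ _)) Po)
  P-multiple {o} Po (suc s) = P-+ o (s * o) Po (P-multiple Po s)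

  ∣⇒P : ∀ {o k} → P o → o ∣ k → P k
  ∣⇒P Po (divides s refl) = P-multiple Po s

  IsLeastPos⇒∣ : ∀ {o k} → IsLeastPos P o → P k → o ∣ k
  IsLeastPos⇒∣ {o} {k} (o≥1 , Po , least) Pk = m%n≡0⇒n∣m k o k%o≡0
    where
    instance
      o≢0 : NonZero o
      o≢0 = >-nonZero o≥1
    P[k%o] : P (k % o)
    P[k%o] = P-∸ _ _ (P-multiple Po (k / o))
                 (subst P (trans (m≡m%n+[m/n]*n k o) (+-comm (k % o) _)) Pk)
    k%o≡0 : k % o ≡ 0
    k%o≡0 with k % o in eq
    ... | zero = refl
    ... | suc r = ⊥-elim (least (suc r) (s≤s z≤n) (subst (_< o) eq (m%n<n k o)) (subst P eq P[k%o]))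

IsOrder : ℕ → ℕ → ℕ → Set
IsOrder m x o = IsLeastPos (λ k → x ^ k ≡ 1 [mod m ]) o

IsOrd⇒IsOrder : ∀ {m x o} → IsOrd m x o → IsOrder m x o
IsOrd⇒IsOrder = IsLeastPos-⇔ (λ _ → CongMod⇒≡mod) (λ _ → ≡mod⇒CongMod)

module _ {m x : ℕ} where
  private
    pow-+ : ∀ a b → x ^ a ≡ 1 [mod m ] → x ^ b ≡ 1 [mod m ] → x ^ (a + b) ≡ 1 [mod m ]
    pow-+ a b xᵃ≡1 xᵇ≡1 = subst (_≡ 1 [mod m ]) (sym (^-distribˡ-+-* x a b)) (≡mod-* xᵃ≡1 xᵇ≡1)

    pow-∸ : ∀ a b → x ^ a ≡ 1 [mod m ] → x ^ (a + b) ≡ 1 [mod m ] → x ^ b ≡ 1 [mod m ]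
    pow-∸ a b xᵃ≡1 xᵃ⁺ᵇ≡1 = ≡mod-trans (≡mod-sym xᵃxᵇ≡xᵇ)
                                 (subst (_≡ 1 [mod m ]) (^-distribˡ-+-* x a b) xᵃ⁺ᵇ≡1)
      where
      xᵃxᵇ≡xᵇ : x ^ a * x ^ b ≡ x ^ b [mod m ]
      xᵃxᵇ≡xᵇ = subst (x ^ a * x ^ b ≡_[mod m ]) (*-identityˡ (x ^ b)) (≡mod-* xᵃ≡1 (≡mod-refl (x ^ b)))

  order-∣ : ∀ {o k} → IsOrder m x o → x ^ k ≡ 1 [mod m ] → o ∣ k
  order-∣ = IsLeastPos⇒∣ pow-+ pow-∸

  pow-multiple-≡1 : ∀ {o k} → x ^ o ≡ 1 [mod m ] → o ∣ k → x ^ k ≡ 1 [mod m ]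
  pow-multiple-≡1 = ∣⇒P pow-+ pow-∸

  IsOrder-∣ : ∀ {t} → 1 ≤ t → x ^ t ≡ 1 [mod m ] → (∀ {k} → x ^ k ≡ 1 [mod m ] → t ∣ k) → IsOrder m x t
  IsOrder-∣ t≥1 xᵗ≡1 ∣t = t≥1 , xᵗ≡1 , λ s s≥1 s<t xˢ≡1 →
    <⇒≱ s<t (∣⇒≤ ⦃ >-nonZero s≥1 ⦄ (∣t xˢ≡1))

  private
    pow-gap≡0 : ∀ {t a b} → Coprime m x → IsOrder m x t → a ≤ b → b < t →
                x ^ a ≡ x ^ b [mod m ] → b ≡ a
    pow-gap≡0 {t} {a} {b} m⊥x ord@(t≥1 , _) a≤b b<t xᵃ≡xᵇ =
      trans (sym (m+[n∸m]≡n a≤b)) (trans (cong (a +_) e≡0) (+-identityʳ a))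
      where
      instance
        t≢0 : NonZero t
        t≢0 = >-nonZero t≥1
      xᵃ*1≡xᵃ*xᵉ : x ^ a * 1 ≡ x ^ a * x ^ (b ∸ a) [mod m ]
      xᵃ*1≡xᵃ*xᵉ = subst₂ _≡_[mod m ] (sym (*-identityʳ _))
                     (trans (cong (x ^_) (sym (m+[n∸m]≡n a≤b))) (^-distribˡ-+-* x a (b ∸ a))) xᵃ≡xᵇ
      e≡0 : b ∸ a ≡ 0
      e≡0 = ∣∧<⇒≡0 (order-∣ ord (≡mod-sym (≡mod-cancel (coprime-^ m⊥x a) xᵃ*1≡xᵃ*xᵉ)))
                   (≤-<-trans (m∸n≤m b a) b<t)

  order-injective : ∀ {t i j} → Coprime m x → IsOrder m x t → i < t → j < t →
                    x ^ i ≡ x ^ j [mod m ] → i ≡ j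
  order-injective {i = i} {j} m⊥x ord i<t j<t xⁱ≡xʲ with ≤-total i j
  ... | inj₁ i≤j = sym (pow-gap≡0 m⊥x ord i≤j j<t xⁱ≡xʲ)
  ... | inj₂ j≤i = pow-gap≡0 m⊥x ord j≤i i<t (≡mod-sym xⁱ≡xʲ)

order-of-power : ∀ {m x ω t} → IsOrder m x (ω * t) → IsOrder m (x ^ ω) t
order-of-power {m} {x} {ω} {t} ord@(ωt≥1 , xᵚᵗ≡1 , _) =
  IsOrder-∣ (>-nonZero⁻¹ t) (subst (_≡ 1 [mod m ]) (sym (^-*-assoc x ω t)) xᵚᵗ≡1)
    λ {k} xᵚᵏ≡1 → *-cancelˡ-∣ ω (order-∣ ord (subst (_≡ 1 [mod m ]) (^-*-assoc x ω k) xᵚᵏ≡1))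
  where
  instance
    ωt≢0 : NonZero (ω * t)
    ωt≢0 = >-nonZero ωt≥1
    ω≢0 : NonZero ω
    ω≢0 = m*n≢0⇒m≢0 ω
    t≢0 : NonZero t
    t≢0 = m*n≢0⇒n≢0 ω

-- Lifting the exponent

triangular : ℕ → ℕ
triangular zero = 0
triangular (suc k) = triangular k + k

triangular-odd : ∀ h → triangular (1 + 2 * h) ≡ (1 + 2 * h) * h
triangular-odd zero = refl
triangular-odd (suc h) = begin
  triangular (1 + 2 * suc h)                         ≡⟨ cong triangular (odd-suc h) ⟩
  triangular (1 + 2 * h) + (1 + 2 * h) + (2 + 2 * h) ≡⟨ cong (λ T → T + (1 + 2 * h) + (2 + 2 * h))
                                                              (triangular-odd h) ⟩
  (1 + 2 * h) * h + (1 + 2 * h) + (2 + 2 * h)        ≡⟨ step h ⟩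
  (1 + 2 * suc h) * suc h                            ∎
  where
  open ≡-Reasoning
  odd-suc : ∀ h → 1 + 2 * suc h ≡ 3 + 2 * h
  odd-suc = solve-∀
  step : ∀ h → (1 + 2 * h) * h + (1 + 2 * h) + (2 + 2 * h) ≡ (1 + 2 * suc h) * suc h
  step = solve-∀

binomial-third-order : ∀ b k → ∃ λ s → (1 + b) ^ k ≡ 1 + k * b + triangular k * (b * b) + b * b * b * s
binomial-third-order b zero = 0 , base b
  where
  base : ∀ b → 1 ≡ 1 + 0 * b + 0 * (b * b) + b * b * b * 0
  base = solve-∀
binomial-third-order b (suc k) with binomial-third-order b k
... | s , expansion =
  s + triangular k + s * b , trans (cong ((1 + b) *_) expansion) (step b k (triangular k) s)
  where
  step : ∀ b k T s → (1 + b) * (1 + k * b + T * (b * b) + b * b * b * s) ≡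
                     1 + suc k * b + (T + k) * (b * b) + b * b * b * (s + T + s * b)
  step = solve-∀

-- p = 2: (1 + 2b₀)² = 1 + 2·(2b₀)·(1 + b₀). Odd p = 1 + 2h, b = p·b₀: since C(p,2) = p·h,
-- (1 + b)^p = 1 + pb + ph·b² + b³s = 1 + pb·(1 + b(h + b₀s)).
binomial-prime-step : ∀ {p b} → Prime p → p ∣ b →
  ∃ λ c → (1 + b) ^ p ≡ 1 + p * b * c × (∀ {r} → Prime r → r ∣ b → (p ≡ 2 → r ≡ 2 → 4 ∣ b) → ¬ r ∣ c)
binomial-prime-step {p} p-prime (divides b₀ refl) with p ≟ 2
... | yes refl = 1 + b₀ , square b₀ , r∤c
  where
  square : ∀ b₀ → (1 + b₀ * 2) * ((1 + b₀ * 2) * 1) ≡ 1 + 2 * (b₀ * 2) * (1 + b₀)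
  square = solve-∀
  r∤c : ∀ {r} → Prime r → r ∣ b₀ * 2 → (2 ≡ 2 → r ≡ 2 → 4 ∣ b₀ * 2) → ¬ r ∣ 1 + b₀
  r∤c {r} r-prime r∣b 4∣b with r ≟ 2
  ... | yes refl = prime∣x⇒∤1+x r-prime (*-cancelʳ-∣ 2 (4∣b refl refl))
  ... | no r≢2 with euclidsLemma b₀ 2 r-prime r∣b
  ...   | inj₁ r∣b₀ = prime∣x⇒∤1+x r-prime r∣b₀
  ...   | inj₂ r∣2 = ⊥-elim (r≢2 (prime∣2⇒≡2 r-prime r∣2))
... | no p≢2 with odd-prime p-prime p≢2
...   | h , refl with binomial-third-order (b₀ * p) p
...     | s , expansion = 1 + b * (h + b₀ * s) , eq , λ r-prime r∣b _ → prime∣x⇒∤1+x r-prime (∣m⇒∣m*n _ r∣b)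
  where
  b = b₀ * (1 + 2 * h)
  regroup : ∀ p h b₀ s →
    1 + p * (b₀ * p) + (p * h) * ((b₀ * p) * (b₀ * p)) + (b₀ * p) * (b₀ * p) * (b₀ * p) * s
      ≡ 1 + p * (b₀ * p) * (1 + (b₀ * p) * (h + b₀ * s))
  regroup = solve-∀
  eq : (1 + b) ^ (1 + 2 * h) ≡ 1 + (1 + 2 * h) * b * (1 + b * (h + b₀ * s))
  eq = trans expansion
         (trans (cong (λ T → 1 + (1 + 2 * h) * b + T * (b * b) + b * b * b * s) (triangular-odd h))
                (regroup (1 + 2 * h) h b₀ s))

-- v_r((1 + a)^m − 1) = v_r(m) + v_r(a) for every prime r ∣ a, with the usual exception at r = 2.
LiftsExponent : ℕ → ℕ → Set
LiftsExponent a m = ∃ λ c → (1 + a) ^ m ≡ 1 + m * a * c ×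
                            (∀ {r} → Prime r → r ∣ a → (r ≡ 2 → 2 ∣ m → 4 ∣ a) → ¬ r ∣ c)

lifts-exponent-product : ∀ {a ps} → All Prime ps → (∀ {p} → Prime p → p ∣ product ps → p ∣ a) →
                         LiftsExponent a (product ps)
lifts-exponent-product {a} {[]} [] _ = 1 , one a , λ r-prime _ _ → prime∤1 r-prime
  where
  one : ∀ a → (1 + a) * 1 ≡ 1 + 1 * a * 1
  one = solve-∀
lifts-exponent-product {a} {p ∷ ps} (p-prime ∷ ps-prime) primes∣a =
  extend (lifts-exponent-product ps-prime λ r-prime r∣P → primes∣a r-prime (∣-trans r∣P (n∣m*n p)))
  where
  P = product ps
  a∣P*a*c : ∀ c → a ∣ P * a * c
  a∣P*a*c c = ∣m⇒∣m*n c (n∣m*n P)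
  extend : LiftsExponent a P → LiftsExponent a (p * P)
  extend (c₁ , expansion₁ , r∤c₁)
    with binomial-prime-step p-prime (∣-trans (primes∣a p-prime (m∣m*n P)) (a∣P*a*c c₁))
  ... | c′ , expansion′ , r∤c′ = c₁ * c′ , eq , r∤c
    where
    b = P * a * c₁
    regroup : ∀ p P a c₁ c′ → 1 + p * (P * a * c₁) * c′ ≡ 1 + p * P * a * (c₁ * c′)
    regroup = solve-∀
    eq : (1 + a) ^ (p * P) ≡ 1 + p * P * a * (c₁ * c′)
    eq = begin
      (1 + a) ^ (p * P)         ≡⟨ cong ((1 + a) ^_) (*-comm p P) ⟩
      (1 + a) ^ (P * p)         ≡⟨ ^-*-assoc (1 + a) P p ⟨
      ((1 + a) ^ P) ^ p         ≡⟨ cong (_^ p) expansion₁ ⟩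
      (1 + b) ^ p               ≡⟨ expansion′ ⟩
      1 + p * b * c′            ≡⟨ regroup p P a c₁ c′ ⟩
      1 + p * P * a * (c₁ * c′) ∎
      where open ≡-Reasoning
    r∤c : ∀ {r} → Prime r → r ∣ a → (r ≡ 2 → 2 ∣ p * P → 4 ∣ a) → ¬ r ∣ c₁ * c′
    r∤c {r} r-prime r∣a 4∣a r∣c with euclidsLemma c₁ c′ r-prime r∣c
    ... | inj₁ r∣c₁ = r∤c₁ r-prime r∣a (λ r≡2 2∣P → 4∣a r≡2 (∣-trans 2∣P (n∣m*n p))) r∣c₁
    ... | inj₂ r∣c′ = r∤c′ r-prime (∣-trans r∣a (a∣P*a*c c₁))
                           (λ { refl r≡2 → ∣-trans (4∣a r≡2 (m∣m*n P)) (a∣P*a*c c₁) }) r∣c′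

lifts-exponent : ∀ {a m} → 1 ≤ m → (∀ {p} → Prime p → p ∣ m → p ∣ a) → LiftsExponent a m
lifts-exponent {a} {m@(suc _)} _ primes∣a with factorise m
... | record { factors = ps ; isFactorisation = m≡ps ; factorsPrime = ps-prime } =
  subst (LiftsExponent a) (sym m≡ps)
        (lifts-exponent-product ps-prime λ p-prime p∣ps → primes∣a p-prime (subst (_ ∣_) (sym m≡ps) p∣ps))

module _ {N a : ℕ} (N≥1 : 1 ≤ N) (primes∣a : ∀ {p} → Prime p → p ∣ N → p ∣ a)
         (8∣N⇒4∣a : 8 ∣ N → 4 ∣ a) where
  private
    instance
      N≢0 : NonZero N
      N≢0 = >-nonZero N≥1
    g = gcd a N
    instance
      g≢0 : NonZero g
      g≢0 = ≢-nonZero (gcd[m,n]≢0 a N (inj₂ (≢-nonZero⁻¹ N)))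
    m = N / g
    h = a / g
    N≡g*m : N ≡ g * m
    N≡g*m = sym (m*[n/m]≡n (gcd[m,n]∣n a N))
    a≡g*h : a ≡ g * h
    a≡g*h = sym (m*[n/m]≡n (gcd[m,n]∣m a N))
    m∣N : m ∣ N
    m∣N = divides g N≡g*m
    m′*a*c≡g*m′*[h*c] : ∀ m′ c → m′ * a * c ≡ g * m′ * (h * c)
    m′*a*c≡g*m′*[h*c] m′ c = trans (cong (λ a → m′ * a * c) a≡g*h) (regroup g h m′ c)
      where
      regroup : ∀ g h m′ c → m′ * (g * h) * c ≡ g * m′ * (h * c)
      regroup = solve-∀
    cofactor≥1 : ∀ {m′ p} → m ≡ m′ * p → 1 ≤ m′
    cofactor≥1 {m′} {p} m≡m′p =
      >-nonZero⁻¹ m′ ⦃ m*n≢0⇒m≢0 m′ ⦃ subst NonZero m≡m′p (m*n≢0⇒n≢0 g ⦃ subst NonZero N≡g*m N≢0 ⦄) ⦄ ⦄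

    pow-m≡1 : (1 + a) ^ m ≡ 1 [mod N ]
    pow-m≡1 with lifts-exponent (cofactor≥1 (sym (*-identityʳ m)))
                                (λ p-prime p∣m → primes∣a p-prime (∣-trans p∣m m∣N))
    ... | c , expansion , _ = subst (_≡ 1 [mod N ]) (sym expansion) (+-multiple-≡mod 1 N∣mac)
      where
      N∣mac : N ∣ m * a * c
      N∣mac = subst₂ _∣_ (sym N≡g*m) (sym (m′*a*c≡g*m′*[h*c] m c)) (m∣m*n (h * c))

    -- N = g·m′·p divides m′·a·c′ = g·m′·(h·c′), so p ∣ h·c′; but p ∤ h as h ⊥ m, and p ∤ c′.
    pow-cofactor-≢1 : ∀ {p m′} → Prime p → m ≡ m′ * p → ¬ (1 + a) ^ m′ ≡ 1 [mod N ]
    pow-cofactor-≢1 {p} {m′} p-prime m≡m′p =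
      refute (lifts-exponent (cofactor≥1 m≡m′p)
                             λ r-prime r∣m′ → primes∣a r-prime (∣-trans r∣m′ m′∣N))
      where
      p∣m : p ∣ m
      p∣m = divides m′ m≡m′p
      m′∣N : m′ ∣ N
      m′∣N = ∣-trans (divides p (trans m≡m′p (*-comm m′ p))) m∣N
      p∣N : p ∣ N
      p∣N = ∣-trans p∣m m∣N
      N≡gm′*p : N ≡ g * m′ * p
      N≡gm′*p = trans N≡g*m (trans (cong (g *_) m≡m′p) (sym (*-assoc g m′ p)))
      instance
        gm′≢0 : NonZero (g * m′)
        gm′≢0 = m*n≢0⇒m≢0 (g * m′) ⦃ subst NonZero N≡gm′*p N≢0 ⦄
      4∣a : p ≡ 2 → 2 ∣ m′ → 4 ∣ a
      4∣a refl 2∣m′ = 8∣N⇒4∣a (subst (8 ∣_) (sym N≡gm′*p) (*-pres-∣ (*-pres-∣ 2∣g 2∣m′) (∣-refl {2})))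
        where
        2∣g : 2 ∣ g
        2∣g = gcd-greatest (primes∣a prime[2] p∣N) p∣N
      refute : LiftsExponent a m′ → ¬ (1 + a) ^ m′ ≡ 1 [mod N ]
      refute (c′ , expansion , r∤c′) pow≡1 =
        [ p∤h , r∤c′ p-prime (primes∣a p-prime p∣N) 4∣a ]′ (euclidsLemma h c′ p-prime p∣hc′)
        where
        N∣m′ac′ : N ∣ m′ * a * c′
        N∣m′ac′ = ≡mod⇒∣∸ (s≤s z≤n) (subst (_≡ 1 [mod N ]) expansion pow≡1)
        p∣hc′ : p ∣ h * c′
        p∣hc′ = *-cancelˡ-∣ (g * m′) (subst₂ _∣_ N≡gm′*p (m′*a*c≡g*m′*[h*c] m′ c′) N∣m′ac′)
        p∤h : ¬ p ∣ h
        p∤h p∣h = ¬prime[1] (subst Prime (coprime-/gcd a N (p∣h , p∣m)) p-prime)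

  order-of-1+ : ∀ {t} → IsOrder N (1 + a) t → N ≡ gcd a N * t
  order-of-1+ {t} order = trans N≡g*m (cong (g *_) (sym t≡m))
    where
    t≡m : t ≡ m
    t≡m = decidable-stable (t ≟ m) λ t≢m →
      let p , m′ , p-prime , m≡m′p , t∣m′ =
            proper-divisor⇒prime-cofactor (cofactor≥1 (sym (*-identityʳ m))) (order-∣ order pow-m≡1) t≢m
      in pow-cofactor-≢1 {p} {m′} p-prime m≡m′p (pow-multiple-≡1 (proj₁ (proj₂ order)) t∣m′)

-- The exponent ω

%4≡3⇒order-2 : ∀ {v} → v % 4 ≡ 3 → IsOrder 4 v 2
%4≡3⇒order-2 {v} v%4≡3 = s≤s z≤n , v²≡1 , not-order-1
  where
  v≡3 : v ≡ 3 [mod 4 ]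
  v≡3 = %≡⇒≡mod v%4≡3
  v²≡1 : v ^ 2 ≡ 1 [mod 4 ]
  v²≡1 = ≡mod-trans (≡mod-^ v≡3 2) (%≡⇒≡mod refl)
  not-order-1 : ∀ s → 1 ≤ s → s < 2 → ¬ v ^ s ≡ 1 [mod 4 ]
  not-order-1 1 _ _ v≡1 =
    3≢1 (≡mod⇒%≡ (≡mod-trans (≡mod-sym v≡3) (subst (_≡ 1 [mod 4 ]) (*-identityʳ v) v≡1)))
    where
    3≢1 : 3 % 4 ≢ 1 % 4
    3≢1 ()
  not-order-1 (suc (suc _)) _ (s≤s (s≤s ()))

odd∧%4≢3⇒≡1 : ∀ {v} → v ≡ 1 [mod 2 ] → v % 4 ≢ 3 → v ≡ 1 [mod 4 ]
odd∧%4≢3⇒≡1 {v} v≡1 v%4≢3 = residue (v % 4) refl (m%n<n v 4)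
  where
  odd : ∀ {r} → v % 4 ≡ r → r % 2 ≡ 1
  odd {r} v%4≡r = trans (cong (_% 2) (sym v%4≡r))
                        (trans (m∣n⇒o%n%m≡o%m 2 4 v (divides 2 refl)) (≡mod⇒%≡ v≡1))
  residue : ∀ r → v % 4 ≡ r → r < 4 → v ≡ 1 [mod 4 ]
  residue 0 v%4≡0 _ = ⊥-elim (0≢1+n (odd v%4≡0))
  residue 1 v%4≡1 _ = %≡⇒≡mod v%4≡1
  residue 2 v%4≡2 _ = ⊥-elim (0≢1+n (odd v%4≡2))
  residue 3 v%4≡3 _ = ⊥-elim (v%4≢3 v%4≡3)
  residue (suc (suc (suc (suc _)))) _ (s≤s (s≤s (s≤s (s≤s ()))))

IsOmega : ℕ → ℕ → ℕ → ℕ → Set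
IsOmega N q o ω = (ω ≡ 2 * o × q ^ o % 4 ≡ 3 × 8 ∣ N) ⊎ (ω ≡ o × ¬ (q ^ o % 4 ≡ 3 × 8 ∣ N))

omega-spec : ∀ n q γ o → IsOmega (nγ n γ) q o (omega n q γ o)
omega-spec n q γ o = cases (((q ^ o) mod 4 ≟ 3) ×-dec (8 ∣? nγ n γ))
  where
  cases : (D : Dec (q ^ o % 4 ≡ 3 × 8 ∣ nγ n γ)) → IsOmega (nγ n γ) q o (if does D then 2 * o else o)
  cases (yes both) = inj₁ (refl , both)
  cases (no ¬both) = inj₂ (refl , ¬both)

omega-multiple : ∀ {N q o ω} → IsOmega N q o ω → o ∣ ω
omega-multiple (inj₁ (refl , _)) = n∣m*n 2
omega-multiple (inj₂ (refl , _)) = ∣-refl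

module _ {N q o ω : ℕ} (N≥1 : 1 ≤ N) (q≥1 : 1 ≤ q)
         (rad-order : IsOrder (rad N) q o) (ω-spec : IsOmega N q o ω) where
  private
    instance
      q≢0 : NonZero q
      q≢0 = >-nonZero q≥1

    q^ω≡1[rad] : q ^ ω ≡ 1 [mod rad N ]
    q^ω≡1[rad] = pow-multiple-≡1 (proj₁ (proj₂ rad-order)) (omega-multiple ω-spec)

    q^ω≡1[p] : ∀ {p} → Prime p → p ∣ N → q ^ ω ≡ 1 [mod p ]
    q^ω≡1[p] p-prime p∣N = ≡mod-∣ (prime∣⇒∣rad N≥1 p-prime p∣N) q^ω≡1[rad]

    q^ω≡1[4] : IsOmega N q o ω → 8 ∣ N → q ^ ω ≡ 1 [mod 4 ]
    q^ω≡1[4] (inj₁ (refl , q^o%4≡3 , _)) _ =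
      subst (_≡ 1 [mod 4 ]) (trans (^-*-assoc q o 2) (cong (q ^_) (*-comm o 2)))
            (proj₁ (proj₂ (%4≡3⇒order-2 {q ^ o} q^o%4≡3)))
    q^ω≡1[4] (inj₂ (refl , ¬both)) 8∣N =
      odd∧%4≢3⇒≡1 (q^ω≡1[p] prime[2] (∣-trans (divides 4 refl) 8∣N)) (λ q^o%4≡3 → ¬both (q^o%4≡3 , 8∣N))

  omega∣order : ∀ {τ} → IsOrder N q τ → ω ∣ τ
  omega∣order {τ} order = from-o∣τ ω-spec (order-∣ rad-order (≡mod-∣ (rad∣ N) q^τ≡1))
    where
    q^τ≡1 : q ^ τ ≡ 1 [mod N ]
    q^τ≡1 = proj₁ (proj₂ order)
    from-o∣τ : IsOmega N q o ω → o ∣ τ → ω ∣ τ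
    from-o∣τ (inj₂ (refl , _)) o∣τ = o∣τ
    from-o∣τ (inj₁ (refl , q^o%4≡3 , 8∣N)) (divides s τ≡s*o) =
      subst (2 * o ∣_) (sym τ≡s*o) (*-monoˡ-∣ o 2∣s)
      where
      q^os≡1 : (q ^ o) ^ s ≡ 1 [mod N ]
      q^os≡1 = subst (_≡ 1 [mod N ])
                     (sym (trans (^-*-assoc q o s) (cong (q ^_) (trans (*-comm o s) (sym τ≡s*o))))) q^τ≡1
      2∣s : 2 ∣ s
      2∣s = order-∣ (%4≡3⇒order-2 {q ^ o} q^o%4≡3) (≡mod-∣ (∣-trans (divides 2 refl) 8∣N) q^os≡1)

  omega-structure : ∀ {τ} → IsOrder N q τ →
                    ∃ λ t → τ ≡ ω * t × N ≡ gcd (q ^ ω ∸ 1) N * t × IsOrder N (q ^ ω) t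
  omega-structure {τ} order with omega∣order order
  ... | divides t τ≡t*ω =
    t , τ≡ω*t , order-of-1+ N≥1 primes∣q^ω∸1 8∣N⇒4∣q^ω∸1 order-of-1+[q^ω∸1] , order-of-q^ω
    where
    τ≡ω*t : τ ≡ ω * t
    τ≡ω*t = trans τ≡t*ω (*-comm t ω)
    order-of-q^ω : IsOrder N (q ^ ω) t
    order-of-q^ω = order-of-power {ω = ω} (subst (IsOrder N q) τ≡ω*t order)
    order-of-1+[q^ω∸1] : IsOrder N (1 + (q ^ ω ∸ 1)) t
    order-of-1+[q^ω∸1] = subst (λ u → IsOrder N u t) (sym (m+[n∸m]≡n (m^n>0 q ω))) order-of-q^ω
    primes∣q^ω∸1 : ∀ {p} → Prime p → p ∣ N → p ∣ q ^ ω ∸ 1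
    primes∣q^ω∸1 p-prime p∣N = ≡mod⇒∣∸ (m^n>0 q ω) (q^ω≡1[p] p-prime p∣N)
    8∣N⇒4∣q^ω∸1 : 8 ∣ N → 4 ∣ q ^ ω ∸ 1
    8∣N⇒4∣q^ω∸1 8∣N = ≡mod⇒∣∸ (m^n>0 q ω) (q^ω≡1[4] ω-spec 8∣N)

-- Blocks of the coset

Fin-injective⇒surjective : ∀ {n} (f : Fin n → Fin n) → Injective _≡_ _≡_ f → ∀ y → ∃ λ x → f x ≡ y
Fin-injective⇒surjective {suc n} f f-inj y with any? (λ x → f x Fin.≟ y)
... | yes hit = hit
... | no miss = ⊥-elim (<⇒≱ (n<1+n n) (injective⇒≤ {f = avoid-y} avoid-y-injective))
  where
  y≢f : ∀ x → y ≢ f x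
  y≢f x y≡fx = miss (x , sym y≡fx)
  avoid-y : Fin (suc n) → Fin n
  avoid-y x = punchOut (y≢f x)
  avoid-y-injective : Injective _≡_ _≡_ avoid-y
  avoid-y-injective eq = f-inj (punchOut-injective (y≢f _) (y≢f _) eq)

-- k ↦ ⌊(x·u^k mod N)/g⌋ is injective on k < t (x ⊥ N, u of order t), and every x·u^k mod N
-- is ≡ x mod g; so it permutes Fin t, and the preimage of 0 gives x·u^k mod N = x mod g.
orbit-meets-least-residue : ∀ {N g t u x} .{{_ : NonZero g}} .{{_ : NonZero N}} →
  N ≡ g * t → IsOrder N u t → u ≡ 1 [mod g ] → Coprime N u → Coprime N x →
  ∃ λ k → k < t × (x * u ^ k) % N ≡ x % g
orbit-meets-least-residue {N} {g} {t} {u} {x} N≡g*t order u≡1 N⊥u N⊥x =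
  from-block (Fin-injective⇒surjective block block-injective (fromℕ< (proj₁ order)))
  where
  z : ℕ → ℕ
  z k = (x * u ^ k) % N

  z%g≡x%g : ∀ k → z k % g ≡ x % g
  z%g≡x%g k = trans (m∣n⇒o%n%m≡o%m g N _ (divides t (trans N≡g*t (*-comm g t))))
                    (≡mod⇒%≡ (subst (x * u ^ k ≡_[mod g ]) (*-identityʳ x) (≡mod-* (≡mod-refl x) (^-≡1 u≡1 k))))

  z≡x%g+[z/g]*g : ∀ k → z k ≡ x % g + (z k / g) * g
  z≡x%g+[z/g]*g k = trans (m≡m%n+[m/n]*n (z k) g) (cong (_+ (z k / g) * g) (z%g≡x%g k))

  z/g<t : ∀ k → z k / g < t
  z/g<t k = m<n*o⇒m/o<n (subst (z k <_) (trans N≡g*t (*-comm g t)) (m%n<n (x * u ^ k) N))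

  block : Fin t → Fin t
  block k = fromℕ< (z/g<t (toℕ k))

  block-injective : Injective _≡_ _≡_ block
  block-injective {k₁} {k₂} eq = toℕ-injective (order-injective N⊥u order (toℕ<n k₁) (toℕ<n k₂) uᵏ¹≡uᵏ²)
    where
    z/g≡z/g : z (toℕ k₁) / g ≡ z (toℕ k₂) / g
    z/g≡z/g = trans (sym (toℕ-fromℕ< _)) (trans (cong toℕ eq) (toℕ-fromℕ< _))
    uᵏ¹≡uᵏ² : u ^ toℕ k₁ ≡ u ^ toℕ k₂ [mod N ]
    uᵏ¹≡uᵏ² = ≡mod-cancel N⊥x (%≡⇒≡mod (trans (z≡x%g+[z/g]*g (toℕ k₁))
                (trans (cong (λ q → x % g + q * g) z/g≡z/g) (sym (z≡x%g+[z/g]*g (toℕ k₂))))))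

  from-block : (∃ λ k → block k ≡ fromℕ< (proj₁ order)) → ∃ λ k → k < t × z k ≡ x % g
  from-block (k , block[k]≡0) = toℕ k , toℕ<n k ,
    trans (z≡x%g+[z/g]*g (toℕ k)) (trans (cong (λ q → x % g + q * g) z/g≡0) (+-identityʳ (x % g)))
    where
    z/g≡0 : z (toℕ k) / g ≡ 0
    z/g≡0 = trans (sym (toℕ-fromℕ< _)) (trans (cong toℕ block[k]≡0) (toℕ-fromℕ< (proj₁ order)))

block-index< : ∀ {ω t j k} → j < ω → k < t → j + ω * k < ω * t
block-index< {ω} {t} {j} {k} j<ω k<t = begin-strict
  j + ω * k   <⟨ +-monoˡ-< (ω * k) j<ω ⟩
  ω + ω * k   ≡⟨ *-suc ω k ⟨
  ω * suc k   ≤⟨ *-monoʳ-≤ ω k<t ⟩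
  ω * t       ∎
  where open ≤-Reasoning

min-over-blocks : ∀ {f h : ℕ → ℕ} {ω t ℓ} → 1 ≤ ω →
  (∀ j k → j < ω → h j ≤ f (j + ω * k)) →
  (∀ j → j < ω → ∃ λ k → k < t × f (j + ω * k) ≡ h j) →
  IsMinOf (λ y → ∃ λ i → i < ω * t × y ≡ f i) ℓ →
  IsMinOf (λ y → ∃ λ j → j < ω × y ≡ h j) ℓ
min-over-blocks {f} {h} {ω} {t} {ℓ} ω≥1 h≤f attained ((i , i<ωt , ℓ≡fi) , ℓ-least) =
  (i % ω , m%n<n i ω , ≤-antisym (ℓ≤h (i % ω) (m%n<n i ω)) h≤ℓ) ,
  λ { y (j , j<ω , y≡hj) → subst (ℓ ≤_) (sym y≡hj) (ℓ≤h j j<ω) }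
  where
  instance
    ω≢0 : NonZero ω
    ω≢0 = >-nonZero ω≥1
  ℓ≤h : ∀ j → j < ω → ℓ ≤ h j
  ℓ≤h j j<ω with attained j j<ω
  ... | k , k<t , f≡h = ℓ-least (h j) (j + ω * k , block-index< j<ω k<t , sym f≡h)
  h≤ℓ : h (i % ω) ≤ ℓ
  h≤ℓ = subst (h (i % ω) ≤_)
              (sym (trans ℓ≡fi (cong f (trans (m≡m%n+[m/n]*n i ω) (cong (i % ω +_) (*-comm (i / ω) ω))))))
              (h≤f (i % ω) (i / ω) (m%n<n i ω))

nγ-reduction : ∀ γ {n} → 1 ≤ n →
               1 ≤ nγ n γ × n ≡ gcd γ n * nγ n γ × ∃ λ γ′ → γ ≡ gcd γ n * γ′ × Coprime γ′ (nγ n γ)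
nγ-reduction γ {n} n≥1 =
  >-nonZero⁻¹ _ ⦃ m*n≢0⇒n≢0 d ⦃ subst NonZero n≡d*N (>-nonZero n≥1) ⦄ ⦄ , n≡d*N ,
  γ / d , sym (m*[n/m]≡n (gcd[m,n]∣m γ n)) , subst (Coprime (γ / d)) (sym (div≡/ n d)) (coprime-/gcd γ n)
  where
  d = gcd γ n
  instance
    d≢0 : NonZero d
    d≢0 = ≢-nonZero (gcd[m,n]≢0 γ n (inj₂ (≢-nonZero⁻¹ n ⦃ >-nonZero n≥1 ⦄)))
  n≡d*N : n ≡ d * nγ n γ
  n≡d*N = trans (sym (m*[n/m]≡n (gcd[m,n]∣n γ n))) (cong (d *_) (sym (div≡/ n d)))

coset-size⇒order : ∀ {n q γ τ d N γ′} → 1 ≤ n → n ≡ d * N → γ ≡ d * γ′ → Coprime γ′ N →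
                   IsCosetSize n q γ τ → IsOrder N q τ
coset-size⇒order {n} {q} {γ} {d = d} {N} {γ′} n≥1 n≡d*N γ≡d*γ′ γ′⊥N coset-size =
  IsLeastPos-⇔ to from coset-size
  where
  instance
    d≢0 : NonZero d
    d≢0 = m*n≢0⇒m≢0 d ⦃ subst NonZero n≡d*N (>-nonZero n≥1) ⦄
  γ*≡ : ∀ x → γ * x ≡ d * (γ′ * x)
  γ*≡ x = trans (cong (_* x) γ≡d*γ′) (*-assoc d γ′ x)

  reduce : ∀ {x y} → γ * x ≡ γ * y [mod n ] → x ≡ y [mod N ]
  reduce {x} {y} γx≡γy = ≡mod-cancel (coprime-sym γ′⊥N)
    (≡mod-unscale d (subst (d * (γ′ * x) ≡ d * (γ′ * y) [mod_]) n≡d*N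
                           (subst₂ _≡_[mod n ] (γ*≡ x) (γ*≡ y) γx≡γy)))

  lift : ∀ {x y} → x ≡ y [mod N ] → γ * x ≡ γ * y [mod n ]
  lift {x} {y} x≡y = subst₂ _≡_[mod n ] (sym (γ*≡ x)) (sym (γ*≡ y))
    (subst (d * (γ′ * x) ≡ d * (γ′ * y) [mod_]) (sym n≡d*N) (≡mod-scale d (≡mod-* (≡mod-refl γ′) x≡y)))

  to : ∀ k → CongMod n (γ * q ^ k) γ → q ^ k ≡ 1 [mod N ]
  to k γqᵏ≡γ = reduce (subst (γ * q ^ k ≡_[mod n ]) (sym (*-identityʳ γ)) (CongMod⇒≡mod γqᵏ≡γ))

  from : ∀ k → q ^ k ≡ 1 [mod N ] → CongMod n (γ * q ^ k) γ
  from k qᵏ≡1 = ≡mod⇒CongMod (subst (γ * q ^ k ≡_[mod n ]) (*-identityʳ γ) (lift qᵏ≡1))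

-- The leader

module CosetLeader {n q γ ω τ d N γ′ t : ℕ} (q≥1 : 1 ≤ q) (n≥1 : 1 ≤ n) (n⊥q : Coprime n q)
                   (n≡d*N : n ≡ d * N) (γ≡d*γ′ : γ ≡ d * γ′) (γ′⊥N : Coprime γ′ N)
                   (τ≥1 : 1 ≤ τ) (τ≡ω*t : τ ≡ ω * t)
                   (N≡g*t : N ≡ gcd (q ^ ω ∸ 1) N * t) (order-of-q^ω : IsOrder N (q ^ ω) t) where
  private
    g = gcd (q ^ ω ∸ 1) N
    x : ℕ → ℕ
    x j = γ′ * q ^ j
    instance
      n≢0 : NonZero n
      n≢0 = >-nonZero n≥1
      d≢0 : NonZero d
      d≢0 = m*n≢0⇒m≢0 d ⦃ subst NonZero n≡d*N n≢0 ⦄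
      N≢0 : NonZero N
      N≢0 = m*n≢0⇒n≢0 d ⦃ subst NonZero n≡d*N n≢0 ⦄
      g≢0 : NonZero g
      g≢0 = m*n≢0⇒m≢0 g ⦃ subst NonZero N≡g*t N≢0 ⦄
      dg≢0 : NonZero (d * g)
      dg≢0 = m*n≢0 d g
      dN≢0 : NonZero (d * N)
      dN≢0 = m*n≢0 d N
      τ≢0 : NonZero τ
      τ≢0 = >-nonZero τ≥1

    N∣n : N ∣ n
    N∣n = divides d n≡d*N

    N⊥q : Coprime N q
    N⊥q (i∣N , i∣q) = n⊥q (∣-trans i∣N N∣n , i∣q)

    dg∣n : d * g ∣ n
    dg∣n = subst (d * g ∣_) (sym n≡d*N) (*-monoʳ-∣ d (divides t (trans N≡g*t (*-comm g t))))

    q^ω≡1[g] : q ^ ω ≡ 1 [mod g ]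
    q^ω≡1[g] = subst (_≡ 1 [mod g ]) (m+[n∸m]≡n (m^n>0 q ⦃ >-nonZero q≥1 ⦄ ω))
                     (+-multiple-≡mod 1 (gcd[m,n]∣m (q ^ ω ∸ 1) N))

    γq^j≡d*x : ∀ j → γ * q ^ j ≡ d * x j
    γq^j≡d*x j = trans (cong (_* q ^ j) γ≡d*γ′) (*-assoc d γ′ (q ^ j))

    γq^[j+ωk]≡d*x*u^k : ∀ j k → γ * q ^ (j + ω * k) ≡ d * (x j * (q ^ ω) ^ k)
    γq^[j+ωk]≡d*x*u^k j k = begin
      γ * q ^ (j + ω * k)         ≡⟨ cong (γ *_) (^-distribˡ-+-* q j (ω * k)) ⟩
      γ * (q ^ j * q ^ (ω * k))   ≡⟨ cong (λ e → γ * (q ^ j * e)) (^-*-assoc q ω k) ⟨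
      γ * (q ^ j * (q ^ ω) ^ k)   ≡⟨ *-assoc γ (q ^ j) _ ⟨
      γ * q ^ j * (q ^ ω) ^ k     ≡⟨ cong (_* (q ^ ω) ^ k) (γq^j≡d*x j) ⟩
      d * x j * (q ^ ω) ^ k       ≡⟨ *-assoc d (x j) _ ⟩
      d * (x j * (q ^ ω) ^ k)     ∎
      where open ≡-Reasoning

    modulus : (ω * n) div τ ≡ d * g
    modulus = trans (div≡/ (ω * n) τ) (trans (cong (_/ τ) ωn≡dg*τ) (m*n/n≡m (d * g) τ))
      where
      regroup : ∀ ω d g t → ω * (d * (g * t)) ≡ d * g * (ω * t)
      regroup = solve-∀
      ωn≡dg*τ : ω * n ≡ d * g * τ
      ωn≡dg*τ = trans (cong (λ n → ω * n) (trans n≡d*N (cong (d *_) N≡g*t)))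
                      (trans (regroup ω d g t) (cong (d * g *_) (sym τ≡ω*t)))

    mod-modulus : ∀ y → y mod ((ω * n) div τ) ≡ y % (d * g)
    mod-modulus y = trans (cong (y mod_) modulus) (mod≡% y (d * g))

  ω≥1 : 1 ≤ ω
  ω≥1 = >-nonZero⁻¹ ω ⦃ m*n≢0⇒m≢0 ω ⦃ subst NonZero τ≡ω*t τ≢0 ⦄ ⦄

  block-lower : ∀ j k → j < ω → (γ * q ^ j) mod ((ω * n) div τ) ≤ (γ * q ^ (j + ω * k)) mod n
  block-lower j k _ = subst₂ _≤_ (sym (mod-modulus (γ * q ^ j))) (sym (mod≡% (γ * q ^ (j + ω * k)) n))
                                (≡mod⇒%≤% dg∣n same-residue)
    where
    same-residue : γ * q ^ (j + ω * k) ≡ γ * q ^ j [mod d * g ]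
    same-residue = subst₂ _≡_[mod d * g ] (sym (γq^[j+ωk]≡d*x*u^k j k))
                          (sym (trans (γq^j≡d*x j) (cong (d *_) (sym (*-identityʳ (x j))))))
                          (≡mod-scale d (≡mod-* (≡mod-refl (x j)) (^-≡1 q^ω≡1[g] k)))

  block-attained : ∀ j → j < ω →
    ∃ λ k → k < t × (γ * q ^ (j + ω * k)) mod n ≡ (γ * q ^ j) mod ((ω * n) div τ)
  block-attained j _ = from-orbit (orbit-meets-least-residue N≡g*t order-of-q^ω q^ω≡1[g]
                                    (coprime-^ N⊥q ω) (coprime-* (coprime-sym γ′⊥N) (coprime-^ N⊥q j)))
    where
    from-orbit : (∃ λ k → k < t × (x j * (q ^ ω) ^ k) % N ≡ x j % g) →
                 ∃ λ k → k < t × (γ * q ^ (j + ω * k)) mod n ≡ (γ * q ^ j) mod ((ω * n) div τ)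
    from-orbit (k , k<t , orbit≡residue) = k , k<t , (begin
      (γ * q ^ (j + ω * k)) mod n         ≡⟨ mod≡% (γ * q ^ (j + ω * k)) n ⟩
      (γ * q ^ (j + ω * k)) % n           ≡⟨ %-congˡ (γq^[j+ωk]≡d*x*u^k j k) ⟩
      (d * (x j * (q ^ ω) ^ k)) % n       ≡⟨ %-congʳ {o = d * (x j * (q ^ ω) ^ k)} n≡d*N ⟩
      (d * (x j * (q ^ ω) ^ k)) % (d * N) ≡⟨ *-distribˡ-% d (x j * (q ^ ω) ^ k) N ⟨
      d * ((x j * (q ^ ω) ^ k) % N)       ≡⟨ cong (d *_) orbit≡residue ⟩
      d * (x j % g)                       ≡⟨ *-distribˡ-% d (x j) g ⟩
      (d * x j) % (d * g)                 ≡⟨ %-congˡ (γq^j≡d*x j) ⟨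
      (γ * q ^ j) % (d * g)               ≡⟨ mod-modulus (γ * q ^ j) ⟨
      (γ * q ^ j) mod ((ω * n) div τ)     ∎)
      where open ≡-Reasoning

coset-leader : ∀ {n q γ τ o ω N d ℓ} → 1 ≤ q → 1 ≤ n → Coprime n q →
  1 ≤ N × n ≡ d * N × (∃ λ γ′ → γ ≡ d * γ′ × Coprime γ′ N) →
  IsCosetSize n q γ τ → IsOrder (rad N) q o → IsOmega N q o ω → IsLeader n q γ τ ℓ →
  IsMinOf (λ y → ∃ λ j → j < ω × y ≡ (γ * q ^ j) mod ((ω * n) div τ)) ℓ
coset-leader {n} {q} {γ} {τ} {ω = ω} {N} {d} {ℓ} q≥1 n≥1 n⊥q (N≥1 , n≡d*N , γ′ , γ≡d*γ′ , γ′⊥N)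
             coset-size rad-order ω-spec leader =
  from-structure (omega-structure {N = N} N≥1 q≥1 rad-order ω-spec
                                  (coset-size⇒order {d = d} n≥1 n≡d*N γ≡d*γ′ γ′⊥N coset-size))
  where
  from-structure : (∃ λ t → τ ≡ ω * t × N ≡ gcd (q ^ ω ∸ 1) N * t × IsOrder N (q ^ ω) t) →
                   IsMinOf (λ y → ∃ λ j → j < ω × y ≡ (γ * q ^ j) mod ((ω * n) div τ)) ℓ
  from-structure (t , τ≡ω*t , N≡g*t , order-of-q^ω) =
    min-over-blocks ω≥1 block-lower block-attained
                    (subst (λ T → IsMinOf (λ y → ∃ λ i → i < T × y ≡ (γ * q ^ i) mod n) ℓ) τ≡ω*t leader)
    where
    open CosetLeader {ω = ω} {d = d} {t = t} q≥1 n≥1 n⊥q n≡d*N γ≡d*γ′ γ′⊥N (proj₁ coset-size)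
                     τ≡ω*t N≡g*t order-of-q^ω

theorem6p1 : ∀ (q n γ : ℕ) → IsPrimePower q → 1 ≤ n → Coprime n q → γ < n →
    ∀ (τ : ℕ) → IsCosetSize n q γ τ →
    ∀ (o : ℕ) → IsOrd (rad (nγ n γ)) q o →
    ∀ (ℓ : ℕ) → IsLeader n q γ τ ℓ →
    IsMinOf (λ x → ∃ λ j → j < omega n q γ o ×
                     x ≡ (γ * q ^ j) mod ((omega n q γ o * n) div τ)) ℓ
theorem6p1 q n γ q-prime-power n≥1 n⊥q _ τ coset-size o rad-order ℓ =
  coset-leader {N = nγ n γ} {d = gcd γ n} (prime-power≥1 q-prime-power) n≥1 n⊥q (nγ-reduction γ n≥1)
               coset-size (IsOrd⇒IsOrder rad-order) (omega-spec n q γ o)
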